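{- A graph $G$ has exactly one Grundy dominating set (i.e., $G$ is a unique Grundy domination graph) if and only if $G$ has no edges.
   Context: For a vertex $v$, $N[v]$ is its closed neighborhood. A closed neighborhood sequence of $G$ is a sequence $(v_1,\ldots,v_k)$ of distinct vertices such that for each $i\in[k]$, $N[v_i]\setminus\bigcup_{j=1}^{i-1}N[v_j]\neq\emptyset$. A Grundy dominating set is the set of vertices of a closed neighborhood sequence of maximum length. -}

module Defs where

open import Level using (0ℓ)
open import Data.Nat using (ℕ; _≤_)
open import Data.Fin using (Fin; toℕ)
open import Data.Fin.Subset using (Subset; _∈_)
open import Data.List using (List; length; lookup; take)
open import Data.List.Relation.Unary.All using (All)
open import Data.List.Relation.Unary.Unique.Propositional using (Unique)
import Data.List.Membership.Propositional as LM
open import Data.Product using (Σ; ∃; _×_)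
open import Data.Sum using (_⊎_)
open import Relation.Nullary using (¬_; Dec)
open import Relation.Binary.PropositionalEquality using (_≡_)
open import Function.Bundles using (_⇔_)

record SimpleGraph (n : ℕ) : Set₁ where
  field
    Adj     : Fin n → Fin n → Set
    sym     : ∀ {u v} → Adj u v → Adj v u
    irrefl  : ∀ {v} → ¬ Adj v v
    dec     : ∀ u v → Dec (Adj u v)

module _ {n : ℕ} (G : SimpleGraph n) where
  open SimpleGraph G

  ClosedNbhd : Fin n → Fin n → Set
  ClosedNbhd v u = u ≡ v ⊎ Adj v u

  Footprinted : List (Fin n) → Fin n → Set
  Footprinted prev v = ∃ λ u → ClosedNbhd v u × All (λ w → ¬ ClosedNbhd w u) prev

  IsCNS : List (Fin n) → Set
  IsCNS s = Unique s × (∀ (i : Fin (length s)) → Footprinted (take (toℕ i) s) (lookup s i))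

  IsGrundySeq : List (Fin n) → Set
  IsGrundySeq s = IsCNS s × (∀ t → IsCNS t → length t ≤ length s)

  IsGrundyDominatingSet : Subset n → Set
  IsGrundyDominatingSet S =
    ∃ λ s → IsGrundySeq s × (∀ v → (v ∈ S) ⇔ (v LM.∈ s))

  UniqueGrundyDomination : Set
  UniqueGrundyDomination =
    ∃ λ S → IsGrundyDominatingSet S × (∀ T → IsGrundyDominatingSet T → T ≡ S)

  Edgeless : Set
  Edgeless = ∀ u v → ¬ Adj u v

{-# OPTIONS --safe #-}
-- Suppose G has an edge ab and s is a Grundy sequence. Not all vertices of s are
-- isolated, else s could be extended by a. Let x be the last non-isolated vertex, so
-- s = p ++ x ∷ q with q isolated, and let u be a vertex footprinted by x. Some
-- neighbour z of x has u ∈ N[z] (z = u if u ≠ x), so p ++ z ∷ q is again a closed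
-- neighbourhood sequence of the same length: z footprints u, and the vertices of q
-- still footprint themselves. As z ∉ s, the two Grundy sequences have different
-- vertex sets. Conversely, in an edgeless graph every vertex footprints itself, so
-- every Grundy sequence enumerates all of V(G).
module Submission where

open import Defs
open import Data.Nat using (ℕ; _≤_)
import Data.Nat.Properties as ℕP
open import Data.Fin using (Fin; zero; suc; toℕ; _≟_)
import Data.Fin.Properties as FinP
open import Data.Fin.Subset using (Subset; ⊤) renaming (_∈_ to _∈ₛ_)
import Data.Fin.Subset.Properties as SubsetP
open import Data.List using (List; []; _∷_; _++_; [_]; length; lookup; take; allFin)
import Data.List.Properties as ListP
open import Data.List.Relation.Unary.All as All using (All; []; _∷_)
open import Data.List.Relation.Unary.AllPairs using ([]; _∷_)
open import Data.List.Relation.Unary.Unique.Propositional using (Unique)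
import Data.List.Relation.Unary.Unique.Propositional.Properties as UniqueP
open import Data.List.Relation.Unary.Any using (here; there)
open import Data.List.Membership.Propositional using (_∈_; _∉_)
import Data.List.Membership.Propositional.Properties as ∈P
open import Data.Product using (∃; _×_; _,_; proj₁; proj₂)
open import Data.Sum using (inj₁; inj₂)
open import Data.Empty using (⊥-elim)
open import Data.Unit using (tt) renaming (⊤ to Unit)
open import Data.Vec using (tabulate)
import Data.Vec.Properties as VecP
open import Function using (_∘_; const)
open import Function.Bundles using (_⇔_; mk⇔; Equivalence)
open import Function.Definitions using (Injective)
open import Relation.Nullary using (¬_; yes; no; does)
open import Relation.Nullary.Decidable using (dec-true)
open import Relation.Binary.PropositionalEquality using (_≡_; _≢_; refl; sym; trans; cong; subst)

open Equivalence using (to; from)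

lookup-injective : ∀ {A : Set} {xs : List A} → Unique xs → Injective _≡_ _≡_ (lookup xs)
lookup-injective {xs = _ ∷ _} _        {zero}  {zero}  _  = refl
lookup-injective {xs = _ ∷ _} (x≢ ∷ _) {zero}  {suc j} eq = ⊥-elim (All.lookup x≢ (∈P.∈-lookup j) eq)
lookup-injective {xs = _ ∷ _} (x≢ ∷ _) {suc i} {zero}  eq = ⊥-elim (All.lookup x≢ (∈P.∈-lookup i) (sym eq))
lookup-injective {xs = _ ∷ _} (_ ∷ u)  {suc i} {suc j} eq = cong suc (lookup-injective u eq)

unique⇒length≤ : ∀ {n} {xs : List (Fin n)} → Unique xs → length xs ≤ n
unique⇒length≤ u = FinP.injective⇒≤ (lookup-injective u)

length-++[]≰ : ∀ {A : Set} (xs : List A) {x : A} → ¬ length (xs ++ [ x ]) ≤ length xs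
length-++[]≰ xs = ℕP.m+1+n≰m (length xs) ∘ subst (_≤ length xs) (ListP.length-++ xs)

∉-++[] : ∀ {A : Set} {xs : List A} {v w : A} → v ∉ xs → v ≢ w → v ∉ xs ++ [ w ]
∉-++[] {xs = xs} v∉xs v≢w v∈ with ∈P.∈-++⁻ xs v∈
... | inj₁ v∈xs       = v∉xs v∈xs
... | inj₂ (here v≡w) = v≢w v≡w

module _ {n : ℕ} where
  open import Data.List.Membership.DecPropositional (_≟_ {n}) using (_∈?_)

  vertexSet : List (Fin n) → Subset n
  vertexSet s = tabulate (λ v → does (v ∈? s))

  ∈-vertexSet⇔ : (s : List (Fin n)) (v : Fin n) → (v ∈ₛ vertexSet s) ⇔ (v ∈ s)
  ∈-vertexSet⇔ s v = mk⇔ ∈ₛ⇒∈ ∈⇒∈ₛ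
    where
    ∈ₛ⇒∈ : v ∈ₛ vertexSet s → v ∈ s
    ∈ₛ⇒∈ h with v ∈? s | trans (sym (VecP.lookup∘tabulate _ v)) (VecP.[]=⇒lookup h)
    ... | yes v∈s | _ = v∈s
    ... | no _    | ()
    ∈⇒∈ₛ : v ∈ s → v ∈ₛ vertexSet s
    ∈⇒∈ₛ v∈s = VecP.lookup⇒[]= v _ (trans (VecP.lookup∘tabulate _ v) (dec-true (v ∈? s) v∈s))

  module _ (G : SimpleGraph n) where
    open SimpleGraph G renaming (sym to Adj-sym)

    Isolated : Fin n → Set
    Isolated v = ∀ u → ¬ Adj v u

    footprinted⇒∉ : ∀ {prev v} → Footprinted G prev v → v ∉ prev
    footprinted⇒∉ (_ , v∼u , fresh) v∈prev = All.lookup fresh v∈prev v∼u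

    footprinted-self : ∀ {prev v} → v ∉ prev → All (λ w → ¬ Adj w v) prev → Footprinted G prev v
    footprinted-self {prev} {v} v∉prev nonadj = v , inj₁ refl , All.zipWith undominated (distinct , nonadj)
      where
      distinct : All (v ≢_) prev
      distinct = All.tabulate (λ w∈prev v≡w → v∉prev (subst (_∈ prev) (sym v≡w) w∈prev))
      undominated : ∀ {w} → v ≢ w × ¬ Adj w v → ¬ ClosedNbhd G w v
      undominated (v≢w , _)   (inj₁ v≡w) = v≢w v≡w
      undominated (_   , ¬wv) (inj₂ wv)  = ¬wv wv

    neighbour-dominating : ∀ {x y u} → Adj x y → ClosedNbhd G x u → ∃ λ z → Adj x z × ClosedNbhd G z u
    neighbour-dominating {y = y} x∼y (inj₁ refl) = y , x∼y , inj₂ (Adj-sym x∼y)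
    neighbour-dominating {u = u} _   (inj₂ x∼u)  = u , x∼u , inj₁ refl

    IsCNSAfter : List (Fin n) → List (Fin n) → Set
    IsCNSAfter prev []      = Unit
    IsCNSAfter prev (v ∷ s) = Footprinted G prev v × IsCNSAfter (prev ++ [ v ]) s

    isCNSAfter⇒lookup : ∀ prev s → IsCNSAfter prev s →
                        ∀ i → Footprinted G (prev ++ take (toℕ i) s) (lookup s i)
    isCNSAfter⇒lookup prev (v ∷ s) (fp , _) zero =
      subst (λ l → Footprinted G l v) (sym (ListP.++-identityʳ prev)) fp
    isCNSAfter⇒lookup prev (v ∷ s) (_ , c) (suc i) =
      subst (λ l → Footprinted G l (lookup s i)) (ListP.++-assoc prev [ v ] _)
        (isCNSAfter⇒lookup (prev ++ [ v ]) s c i)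

    lookup⇒isCNSAfter : ∀ prev s → (∀ i → Footprinted G (prev ++ take (toℕ i) s) (lookup s i)) →
                        IsCNSAfter prev s
    lookup⇒isCNSAfter prev []      _  = tt
    lookup⇒isCNSAfter prev (v ∷ s) fp =
      subst (λ l → Footprinted G l v) (ListP.++-identityʳ prev) (fp zero) ,
      lookup⇒isCNSAfter (prev ++ [ v ]) s (λ i →
        subst (λ l → Footprinted G l (lookup s i)) (sym (ListP.++-assoc prev [ v ] _)) (fp (suc i)))

    isCNSAfter⇒fresh : ∀ {prev s} → IsCNSAfter prev s → All (_∉ prev) s
    isCNSAfter⇒fresh {s = []}    _         = []
    isCNSAfter⇒fresh {s = _ ∷ _} (fp , c) =
      footprinted⇒∉ fp ∷ All.map (λ w∉ → w∉ ∘ ∈P.∈-++⁺ˡ) (isCNSAfter⇒fresh c)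

    isCNSAfter⇒unique : ∀ {prev s} → IsCNSAfter prev s → Unique s
    isCNSAfter⇒unique {s = []}        _       = []
    isCNSAfter⇒unique {prev} {_ ∷ _} (_ , c) =
      All.map (λ w∉ v≡w → w∉ (∈P.∈-++⁺ʳ prev (here (sym v≡w)))) (isCNSAfter⇒fresh c) ∷
      isCNSAfter⇒unique c

    isCNS⇔isCNSAfter[] : ∀ {s} → IsCNS G s ⇔ IsCNSAfter [] s
    isCNS⇔isCNSAfter[] {s} = mk⇔ (lookup⇒isCNSAfter [] s ∘ proj₂)
                                  (λ c → isCNSAfter⇒unique c , isCNSAfter⇒lookup [] s c)

    isCNSAfter-++⁻ : ∀ prev s t → IsCNSAfter prev (s ++ t) → IsCNSAfter prev s × IsCNSAfter (prev ++ s) t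
    isCNSAfter-++⁻ prev []      t c = tt , subst (λ l → IsCNSAfter l t) (sym (ListP.++-identityʳ prev)) c
    isCNSAfter-++⁻ prev (v ∷ s) t (fp , c) with isCNSAfter-++⁻ (prev ++ [ v ]) s t c
    ... | cs , ct = (fp , cs) , subst (λ l → IsCNSAfter l t) (ListP.++-assoc prev [ v ] s) ct

    isCNSAfter-++⁺ : ∀ prev s t → IsCNSAfter prev s → IsCNSAfter (prev ++ s) t → IsCNSAfter prev (s ++ t)
    isCNSAfter-++⁺ prev []      t _        ct = subst (λ l → IsCNSAfter l t) (ListP.++-identityʳ prev) ct
    isCNSAfter-++⁺ prev (v ∷ s) t (fp , cs) ct =
      fp , isCNSAfter-++⁺ (prev ++ [ v ]) s t cs
             (subst (λ l → IsCNSAfter l t) (sym (ListP.++-assoc prev [ v ] s)) ct)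

    isolated⇒isCNSAfter : ∀ {prev s} → All Isolated s → Unique s → All (_∉ prev) s →
                          IsCNSAfter prev s
    isolated⇒isCNSAfter {s = []}    _           _         _             = tt
    isolated⇒isCNSAfter {s = _ ∷ _} (iv ∷ isoS) (v≢ ∷ u) (v∉ ∷ fresh) =
      footprinted-self v∉ (All.tabulate (λ {w} _ w∼v → iv w (Adj-sym w∼v))) ,
      isolated⇒isCNSAfter isoS u (All.zipWith (λ (w∉ , v≢w) → ∉-++[] w∉ (v≢w ∘ sym)) (fresh , v≢))

    data LastNonIsolated : List (Fin n) → Set where
      allIsolated     : ∀ {s} → All Isolated s → LastNonIsolated s
      lastNonIsolated : ∀ p {x y} q → Adj x y → All Isolated q → LastNonIsolated (p ++ x ∷ q)

    lastNonIsolated? : ∀ s → LastNonIsolated s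
    lastNonIsolated? [] = allIsolated []
    lastNonIsolated? (v ∷ s) with lastNonIsolated? s
    ... | lastNonIsolated p q x∼y isoQ = lastNonIsolated (v ∷ p) q x∼y isoQ
    ... | allIsolated isoS with FinP.any? (dec v)
    ...   | yes (_ , v∼y) = lastNonIsolated [] s v∼y isoS
    ...   | no ¬v∼        = allIsolated ((λ u v∼u → ¬v∼ (u , v∼u)) ∷ isoS)

    swap-lastNonIsolated : ∀ p {x y} q → IsCNSAfter [] (p ++ x ∷ q) → All Isolated q → Adj x y →
                           ∃ λ z → z ∉ p ++ x ∷ q × IsCNSAfter [] (p ++ z ∷ q)
    swap-lastNonIsolated p {x} q c isoQ x∼y with isCNSAfter-++⁻ [] p (x ∷ q) c
    ... | cp , (u , x∼u , fresh) , cq with neighbour-dominating x∼y x∼u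
    ...   | z , x∼z , z∼u = z , z∉ , isCNSAfter-++⁺ [] p (z ∷ q) cp (fz , cq′)
      where
      fz : Footprinted G p z
      fz = u , z∼u , fresh
      isolated≢z : ∀ {w} → Isolated w → w ≢ z
      isolated≢z iw w≡z = iw x (Adj-sym (subst (Adj x) (sym w≡z) x∼z))
      cq′ : IsCNSAfter (p ++ [ z ]) q
      cq′ = isolated⇒isCNSAfter isoQ (isCNSAfter⇒unique cq)
              (All.zipWith (λ (w∉ , iw) → ∉-++[] (w∉ ∘ ∈P.∈-++⁺ˡ) (isolated≢z iw))
                           (isCNSAfter⇒fresh cq , isoQ))
      z∉ : z ∉ p ++ x ∷ q
      z∉ z∈ with ∈P.∈-++⁻ p z∈
      ... | inj₁ z∈p         = footprinted⇒∉ fz z∈p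
      ... | inj₂ (here z≡x)  = irrefl (subst (Adj x) z≡x x∼z)
      ... | inj₂ (there z∈q) = isolated≢z (All.lookup isoQ z∈q) refl

    grundySeq⇒¬footprinted : ∀ {s v} → IsGrundySeq G s → ¬ Footprinted G s v
    grundySeq⇒¬footprinted {s} (cs , maximal) fp =
      length-++[]≰ s (maximal _ (from isCNS⇔isCNSAfter[]
        (isCNSAfter-++⁺ [] s [ _ ] (to isCNS⇔isCNSAfter[] cs) (fp , tt))))

    grundySeq-sameLength : ∀ {s t} → IsGrundySeq G s → IsCNS G t → length t ≡ length s → IsGrundySeq G t
    grundySeq-sameLength (_ , maximal) ct eq = ct , λ r cr → subst (length r ≤_) (sym eq) (maximal r cr)

    grundySeq⇒grundyDominatingSet : ∀ {s} → IsGrundySeq G s → IsGrundyDominatingSet G (vertexSet s)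
    grundySeq⇒grundyDominatingSet {s} gs = s , gs , ∈-vertexSet⇔ s

    grundySeq-swap : ∀ {s a b} → IsGrundySeq G s → Adj a b →
                     ∃ λ t → IsGrundySeq G t × ∃ λ v → v ∈ t × v ∉ s
    grundySeq-swap {s} {a} {b} gs a∼b with lastNonIsolated? s
    ... | allIsolated isoS =
      ⊥-elim (grundySeq⇒¬footprinted gs (footprinted-self a∉s (All.map (λ iw → iw a) isoS)))
      where
      a∉s : a ∉ s
      a∉s a∈s = All.lookup isoS a∈s b a∼b
    ... | lastNonIsolated p q x∼y isoQ
      with swap-lastNonIsolated p q (to isCNS⇔isCNSAfter[] (proj₁ gs)) isoQ x∼y
    ...   | z , z∉ , c′ =
      p ++ z ∷ q ,
      grundySeq-sameLength gs (from isCNS⇔isCNSAfter[] c′)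
        (trans (ListP.length-++ p) (sym (ListP.length-++ p))) ,
      z , ∈P.∈-++⁺ʳ p (here refl) , z∉

    uniqueGrundy⇒sameVertices : UniqueGrundyDomination G → ∀ {s t} → IsGrundySeq G s → IsGrundySeq G t →
                                ∀ {v} → v ∈ t → v ∈ s
    uniqueGrundy⇒sameVertices (_ , _ , unique) {s} {t} gs gt {v} v∈t =
      to (∈-vertexSet⇔ s v) (subst (v ∈ₛ_) vertexSet-t≡s (from (∈-vertexSet⇔ t v) v∈t))
      where
      vertexSet-t≡s : vertexSet t ≡ vertexSet s
      vertexSet-t≡s = trans (unique _ (grundySeq⇒grundyDominatingSet gt))
                            (sym (unique _ (grundySeq⇒grundyDominatingSet gs)))

    uniqueGrundy⇒edgeless : UniqueGrundyDomination G → Edgeless G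
    uniqueGrundy⇒edgeless ug@(_ , (_ , gs , _) , _) a b a∼b with grundySeq-swap gs a∼b
    ... | _ , gt , _ , v∈t , v∉s = v∉s (uniqueGrundy⇒sameVertices ug gs gt v∈t)

    edgeless⇒isCNS : Edgeless G → ∀ {s} → Unique s → IsCNS G s
    edgeless⇒isCNS E u =
      from isCNS⇔isCNSAfter[] (isolated⇒isCNSAfter (All.tabulate (λ {v} _ → E v)) u (All.tabulate (λ _ ())))

    edgeless⇒grundySeq-allFin : Edgeless G → IsGrundySeq G (allFin n)
    edgeless⇒grundySeq-allFin E =
      edgeless⇒isCNS E (UniqueP.allFin⁺ n) ,
      λ t ct → subst (length t ≤_) (sym (ListP.length-tabulate (λ v → v))) (unique⇒length≤ (proj₁ ct))

    edgeless⇒grundySeq-complete : Edgeless G → ∀ {s} → IsGrundySeq G s → ∀ v → v ∈ s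
    edgeless⇒grundySeq-complete E {s} gs v with v ∈? s
    ... | yes v∈s = v∈s
    ... | no v∉s  =
      ⊥-elim (grundySeq⇒¬footprinted gs (footprinted-self v∉s (All.tabulate (λ {w} _ → E w v))))

    edgeless⇒uniqueGrundy : Edgeless G → UniqueGrundyDomination G
    edgeless⇒uniqueGrundy E =
      ⊤ ,
      (allFin n , edgeless⇒grundySeq-allFin E , λ v → mk⇔ (const (∈P.∈-allFin v)) (const SubsetP.∈⊤)) ,
      λ { _ (_ , gs , ∈T⇔∈s) → SubsetP.⊆-antisym (const SubsetP.∈⊤)
                                 (λ {v} _ → from (∈T⇔∈s v) (edgeless⇒grundySeq-complete E gs v)) }

corollary4p3 : ∀ (n : ℕ) (G : SimpleGraph n) → UniqueGrundyDomination G ⇔ Edgeless G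
corollary4p3 n G = mk⇔ (uniqueGrundy⇒edgeless G) (edgeless⇒uniqueGrundy G)
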